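{- Let $G$ be a finite simple graph such that the family $\Psi(G)$ of local maximum stable sets of $G$ is a greedoid on $V(G)$. Then for every induced cycle $C_k$ of $G$ with $k\geq 4$ vertices, $\Omega(C_k)\cap\Psi(G)=\emptyset$; that is, no maximum stable set of the cycle $C_k$ is a local maximum stable set of $G$.
   Context: All graphs are finite, simple (undirected, no loops, no multiple edges). For $A\subseteq V(G)$, $N(A)=\{v\in V(G)-A: v \text{ has a neighbor in } A\}$ and $N[A]=A\cup N(A)$; $G[X]$ denotes the subgraph induced by $X$. A stable set is a set of pairwise non-adjacent vertices; $\Omega(H)$ denotes the family of all maximum-cardinality stable sets of a graph $H$. A set $A\subseteq V(G)$ is a local maximum stable set of $G$ if $A\in\Omega(G[N[A]])$; $\Psi(G)$ is the family of all local maximum stable sets of $G$. A greedoid on a finite set $V$ is a pair $(V,\mathcal{F})$ with $\emptyset\neq\mathcal{F}\subseteq 2^V$ satisfying (accessibility) every non-empty $X\in\mathcal{F}$ contains some $x$ with $X-\{x\}\in\mathcal{F}$, and (exchange) for $X,Y\in\mathcal{F}$ with $|X|=|Y|+1$ there is $x\in X-Y$ with $Y\cup\{x\}\in\mathcal{F}$. $C_k$ denotes a chordless cycle on $k$ vertices; an induced cycle of $G$ is a cycle whose vertex set induces a chordless cycle in $G$. -}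

module Defs where

open import Data.Nat using (ℕ; zero; suc; _≤_; _∸_)
open import Data.Fin using (Fin; toℕ)
open import Data.Fin.Subset using (Subset; _∈_; _∉_; _⊆_; _∪_; _-_; ⁅_⁆; ∣_∣)
open import Data.Bool using (Bool; true; false)
open import Data.Product using (Σ; ∃; _×_; _,_)
open import Data.Sum using (_⊎_)
open import Data.Empty using (⊥)
open import Relation.Binary.PropositionalEquality using (_≡_; _≢_)
open import Relation.Nullary using (¬_)
open import Function.Definitions using (Injective)

record Graph (n : ℕ) : Set where
  field
    adj   : Fin n → Fin n → Bool
    sym   : ∀ u v → adj u v ≡ adj v u
    irrefl : ∀ v → adj v v ≡ false

open Graph public

module _ {n : ℕ} (G : Graph n) where

  Adj : Fin n → Fin n → Set
  Adj u v = adj G u v ≡ true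

  InOpenNbhd : Subset n → Fin n → Set
  InOpenNbhd A v = v ∉ A × ∃ λ u → u ∈ A × Adj u v

  InClosedNbhd : Subset n → Fin n → Set
  InClosedNbhd A v = v ∈ A ⊎ InOpenNbhd A v

  Stable : Subset n → Set
  Stable A = ∀ u v → u ∈ A → v ∈ A → ¬ Adj u v

  StableIn : (Fin n → Set) → Subset n → Set
  StableIn X A = (∀ v → v ∈ A → X v) × Stable A

  MaxStableIn : (Fin n → Set) → Subset n → Set
  MaxStableIn X A = StableIn X A × (∀ B → StableIn X B → ∣ B ∣ ≤ ∣ A ∣)

  Ψ : Subset n → Set
  Ψ A = MaxStableIn (InClosedNbhd A) A

  CycAdj : (k : ℕ) → Fin k → Fin k → Set
  CycAdj k i j = toℕ j ≡ suc (toℕ i) ⊎ toℕ i ≡ suc (toℕ j)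
               ⊎ (toℕ i ≡ 0 × toℕ j ≡ k ∸ 1) ⊎ (toℕ j ≡ 0 × toℕ i ≡ k ∸ 1)

  IsInducedCycle : (k : ℕ) → (Fin k → Fin n) → Set
  IsInducedCycle k c = Injective _≡_ _≡_ c
    × (∀ i j → (Adj (c i) (c j) → CycAdj k i j) × (CycAdj k i j → Adj (c i) (c j)))

  InImage : {k : ℕ} → (Fin k → Fin n) → Fin n → Set
  InImage c v = ∃ λ i → c i ≡ v

IsGreedoid : {n : ℕ} → (Subset n → Set) → Set
IsGreedoid {n} F =
    (∃ λ X → F X)
  × (∀ X → F X → (∃ λ v → v ∈ X) → ∃ λ x → x ∈ X × F (X - x))
  × (∀ X Y → F X → F Y → ∣ X ∣ ≡ suc ∣ Y ∣ → ∃ λ x → x ∈ X × x ∉ Y × F (Y ∪ ⁅ x ⁆))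

-- Accessibility alone does the work. Descending from a feasible A one element at a time
-- ends in a feasible singleton {a} ⊆ A. But a local maximum stable singleton {a} forces
-- N(a) to be a clique, since two non-adjacent neighbours of a would form a larger stable
-- set inside N[{a}]; on an induced cycle of length at least 4 the two cycle-neighbours of
-- any vertex are non-adjacent.
module Submission where

open import Defs hiding (sym)
open import Data.Nat using (ℕ; zero; suc; _+_; _≤_; _<_; _∸_; z≤n; s≤s)
open import Data.Nat.Properties using (≤∧≢⇒<; ≤-pred; <-trans; <-≤-trans; n<1+n; n≮n; m≤n⇒m≤1+n; <⇒≢; m<n⇒m<1+n; suc-injective)
  renaming (_≟_ to _≟ℕ_; ≤-refl to ≤ℕ-refl)
open import Data.Nat.Induction using (<-wellFounded)
open import Data.Fin using (Fin; toℕ; fromℕ<) renaming (zero to fzero)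
open import Data.Fin.Properties using (toℕ-fromℕ<; toℕ<n) renaming (_≟_ to _≟F_)
open import Data.Fin.Subset using (Subset; _∈_; _∉_; _⊆_; _⊂_; _∪_; _-_; ⁅_⁆; ∣_∣; Nonempty; Empty)
open import Data.Fin.Subset.Properties
  using (x∈⁅x⁆; x∈⁅y⁆⇒x≡y; x≢y⇒x∉⁅y⁆; ∣⁅x⁆∣≡1; ⊆-antisym; p⊂q⇒∣p∣<∣q∣;
         x∈p∪q⁻; x∈p∪q⁺; p─q⊆p; x∈p∧x≢y⇒x∈p-y; x∈p⇒∣p-x∣<∣p∣; nonempty?; Empty-unique; ∣⊥∣≡0)
open import Data.Product using (∃; ∃₂; _×_; _,_; proj₁; proj₂)
open import Data.Sum using (_⊎_; inj₁; inj₂)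
open import Data.Empty using (⊥-elim)
open import Induction.WellFounded using (Acc; acc)
open import Relation.Nullary using (¬_; yes; no)
open import Relation.Binary.PropositionalEquality using (_≡_; _≢_; refl; sym; trans; cong; subst; subst₂)
open import Function.Definitions using (Injective)

private
  variable
    n : ℕ

Accessible : (Subset n → Set) → Set
Accessible F = ∀ X → F X → Nonempty X → ∃ λ x → x ∈ X × F (X - x)

Empty[p-x]⇒p≡⁅x⁆ : ∀ {p : Subset n} {x} → x ∈ p → Empty (p - x) → p ≡ ⁅ x ⁆
Empty[p-x]⇒p≡⁅x⁆ {p = p} {x} x∈p empty = ⊆-antisym p⊆⁅x⁆ ⁅x⁆⊆p
  where
  p⊆⁅x⁆ : p ⊆ ⁅ x ⁆
  p⊆⁅x⁆ {y} y∈p with y ≟F x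
  ... | yes refl = x∈⁅x⁆ x
  ... | no y≢x   = ⊥-elim (empty (y , x∈p∧x≢y⇒x∈p-y y∈p y≢x))
  ⁅x⁆⊆p : ⁅ x ⁆ ⊆ p
  ⁅x⁆⊆p y∈⁅x⁆ = subst (_∈ p) (sym (x∈⁅y⁆⇒x≡y x y∈⁅x⁆)) x∈p

accessible⇒singleton : {F : Subset n → Set} → Accessible F →
                       ∀ {X} → F X → Nonempty X → ∃ λ x → x ∈ X × F ⁅ x ⁆
accessible⇒singleton {F = F} accessible {X} = descend (<-wellFounded ∣ X ∣)
  where
  descend : ∀ {X} → Acc _<_ ∣ X ∣ → F X → Nonempty X → ∃ λ x → x ∈ X × F ⁅ x ⁆
  descend {X} (acc smaller) FX X≠∅ with accessible X FX X≠∅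
  ... | x , x∈X , F[X-x] with nonempty? (X - x)
  ... | no  X-x=∅ = x , x∈X , subst F (Empty[p-x]⇒p≡⁅x⁆ x∈X X-x=∅) FX
  ... | yes X-x≠∅ with descend (smaller (x∈p⇒∣p-x∣<∣p∣ x∈X)) F[X-x] X-x≠∅
  ...   | y , y∈X-x , F⁅y⁆ = y , p─q⊆p X ⁅ x ⁆ y∈X-x , F⁅y⁆

1≤∣p∣⇒Nonempty : ∀ {p : Subset n} → 1 ≤ ∣ p ∣ → Nonempty p
1≤∣p∣⇒Nonempty {n} {p} 1≤∣p∣ with nonempty? p
... | yes p≠∅ = p≠∅
... | no  p=∅ with subst (λ q → 1 ≤ ∣ q ∣) (Empty-unique p=∅) 1≤∣p∣
...   | 1≤∣⊥∣ with subst (1 ≤_) (∣⊥∣≡0 n) 1≤∣⊥∣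
...     | ()

x≢y⇒1<∣⁅x⁆∪⁅y⁆∣ : ∀ {x y : Fin n} → x ≢ y → 1 < ∣ ⁅ x ⁆ ∪ ⁅ y ⁆ ∣
x≢y⇒1<∣⁅x⁆∪⁅y⁆∣ {x = x} {y} x≢y = subst (_< ∣ ⁅ x ⁆ ∪ ⁅ y ⁆ ∣) (∣⁅x⁆∣≡1 x) (p⊂q⇒∣p∣<∣q∣ ⁅x⁆⊂⁅x⁆∪⁅y⁆)
  where
  ⁅x⁆⊂⁅x⁆∪⁅y⁆ : ⁅ x ⁆ ⊂ ⁅ x ⁆ ∪ ⁅ y ⁆
  ⁅x⁆⊂⁅x⁆∪⁅y⁆ = (λ z∈⁅x⁆ → x∈p∪q⁺ (inj₁ z∈⁅x⁆))
              , y , x∈p∪q⁺ (inj₂ (x∈⁅x⁆ y)) , x≢y⇒x∉⁅y⁆ (λ y≡x → x≢y (sym y≡x))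

module _ (G : Graph n) where

  ¬Adj-refl : ∀ v → ¬ Adj G v v
  ¬Adj-refl v e with trans (sym e) (irrefl G v)
  ... | ()

  Adj-sym : ∀ {u v} → Adj G u v → Adj G v u
  Adj-sym {u} {v} e = trans (Graph.sym G v u) e

  Stable-⁅⁆ : ∀ v → Stable G ⁅ v ⁆
  Stable-⁅⁆ v u w u∈ w∈ u~w rewrite x∈⁅y⁆⇒x≡y v u∈ | x∈⁅y⁆⇒x≡y v w∈ = ¬Adj-refl v u~w

  StableIn-⁅⁆ : ∀ {X : Fin n → Set} {v} → X v → StableIn G X ⁅ v ⁆
  StableIn-⁅⁆ {X} {v} Xv = (λ u u∈⁅v⁆ → subst X (sym (x∈⁅y⁆⇒x≡y v u∈⁅v⁆)) Xv) , Stable-⁅⁆ v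

  MaxStableIn⇒Nonempty : ∀ {X : Fin n → Set} {v A} → X v → MaxStableIn G X A → Nonempty A
  MaxStableIn⇒Nonempty {v = v} {A} Xv (_ , maximum) =
    1≤∣p∣⇒Nonempty (subst (_≤ ∣ A ∣) (∣⁅x⁆∣≡1 v) (maximum ⁅ v ⁆ (StableIn-⁅⁆ Xv)))

  Ψ⁅a⁆⇒nonadjacent-neighbours-equal : ∀ {a u w} → Ψ G ⁅ a ⁆ →
    Adj G a u → Adj G a w → ¬ Adj G u w → u ≡ w
  Ψ⁅a⁆⇒nonadjacent-neighbours-equal {a} {u} {w} (_ , maximum) a~u a~w u≁w with u ≟F w
  ... | yes u≡w = u≡w
  ... | no  u≢w = ⊥-elim (n≮n 1 (subst (1 <_) (∣⁅x⁆∣≡1 a)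
                    (<-≤-trans (x≢y⇒1<∣⁅x⁆∪⁅y⁆∣ u≢w) (maximum (⁅ u ⁆ ∪ ⁅ w ⁆) pair-stable))))
    where
    neighbour-in-N[a] : ∀ {v} → Adj G a v → InClosedNbhd G ⁅ a ⁆ v
    neighbour-in-N[a] {v} a~v = inj₂ (v∉⁅a⁆ , a , x∈⁅x⁆ a , a~v)
      where
      v∉⁅a⁆ : v ∉ ⁅ a ⁆
      v∉⁅a⁆ v∈⁅a⁆ = ¬Adj-refl a (subst (Adj G a) (x∈⁅y⁆⇒x≡y a v∈⁅a⁆) a~v)
    member : ∀ {v} → v ∈ ⁅ u ⁆ ∪ ⁅ w ⁆ → v ≡ u ⊎ v ≡ w
    member {v} v∈ with x∈p∪q⁻ ⁅ u ⁆ ⁅ w ⁆ v∈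
    ... | inj₁ v∈⁅u⁆ = inj₁ (x∈⁅y⁆⇒x≡y u v∈⁅u⁆)
    ... | inj₂ v∈⁅w⁆ = inj₂ (x∈⁅y⁆⇒x≡y w v∈⁅w⁆)
    pair-stable : StableIn G (InClosedNbhd G ⁅ a ⁆) (⁅ u ⁆ ∪ ⁅ w ⁆)
    pair-stable = in-N[a] , stable
      where
      in-N[a] : ∀ v → v ∈ ⁅ u ⁆ ∪ ⁅ w ⁆ → InClosedNbhd G ⁅ a ⁆ v
      in-N[a] v v∈ with member v∈
      ... | inj₁ refl = neighbour-in-N[a] a~u
      ... | inj₂ refl = neighbour-in-N[a] a~w
      stable : Stable G (⁅ u ⁆ ∪ ⁅ w ⁆)
      stable v v' v∈ v'∈ v~v' with member v∈ | member v'∈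
      ... | inj₁ refl | inj₁ refl = ¬Adj-refl u v~v'
      ... | inj₂ refl | inj₂ refl = ¬Adj-refl w v~v'
      ... | inj₁ refl | inj₂ refl = u≁w v~v'
      ... | inj₂ refl | inj₁ refl = u≁w (Adj-sym v~v')

NonadjacentNeighbours : {A : Set} → (A → A → Set) → A → Set
NonadjacentNeighbours R t = ∃₂ λ p q → R t p × R t q × ¬ R p q × p ≢ q

Consecutive : ℕ → ℕ → ℕ → Set
Consecutive k a b = b ≡ suc a ⊎ a ≡ suc b ⊎ (a ≡ 0 × b ≡ k ∸ 1) ⊎ (b ≡ 0 × a ≡ k ∸ 1)

n≢2+n : ∀ n → n ≢ 2 + n
n≢2+n n = <⇒≢ (m<n⇒m<1+n (n<1+n n))

n≢3+n : ∀ n → n ≢ 3 + n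
n≢3+n n = <⇒≢ (m<n⇒m<1+n (m<n⇒m<1+n (n<1+n n)))

consecutive-neighbours : ∀ r {t} → t < 4 + r → ∃₂ λ p q → p < 4 + r × q < 4 + r ×
  Consecutive (4 + r) t p × Consecutive (4 + r) t q × ¬ Consecutive (4 + r) p q × p ≢ q
consecutive-neighbours r {zero} _ =
  3 + r , 1 , ≤ℕ-refl , s≤s (s≤s z≤n) , inj₂ (inj₂ (inj₁ (refl , refl))) , inj₁ refl , apart , λ ()
  where
  apart : ¬ Consecutive (4 + r) (3 + r) 1
  apart (inj₁ ())
  apart (inj₂ (inj₁ ()))
  apart (inj₂ (inj₂ (inj₁ (() , _))))
  apart (inj₂ (inj₂ (inj₂ (() , _))))
consecutive-neighbours r {suc s} s<3+r with s ≟ℕ 2 + r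
... | yes refl =
  2 + r , 0 , m≤n⇒m≤1+n ≤ℕ-refl , s≤s z≤n , inj₂ (inj₁ refl) , inj₂ (inj₂ (inj₂ (refl , refl))) , apart , λ ()
  where
  apart : ¬ Consecutive (4 + r) (2 + r) 0
  apart (inj₁ ())
  apart (inj₂ (inj₁ ()))
  apart (inj₂ (inj₂ (inj₁ (() , _))))
  apart (inj₂ (inj₂ (inj₂ (_ , 2+r≡3+r)))) = <⇒≢ (n<1+n (2 + r)) 2+r≡3+r
... | no s≢2+r =
  s , 2 + s , <-trans (n<1+n s) s<3+r , s≤s (≤∧≢⇒< (≤-pred s<3+r) (λ e → s≢2+r (suc-injective e))) ,
  inj₂ (inj₁ refl) , inj₁ refl , apart , n≢2+n s
  where
  apart : ¬ Consecutive (4 + r) s (2 + s)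
  apart (inj₁ 2+s≡1+s) = <⇒≢ (n<1+n (suc s)) (sym 2+s≡1+s)
  apart (inj₂ (inj₁ s≡3+s)) = n≢3+n s s≡3+s
  apart (inj₂ (inj₂ (inj₁ (refl , ()))))
  apart (inj₂ (inj₂ (inj₂ (() , _))))

-- Definitionally CycAdj G k, which does not actually depend on G.
CycleAdj : (k : ℕ) → Fin k → Fin k → Set
CycleAdj k i j = Consecutive k (toℕ i) (toℕ j)

cycle-nonadjacent-neighbours : ∀ r (i : Fin (4 + r)) → NonadjacentNeighbours (CycleAdj (4 + r)) i
cycle-nonadjacent-neighbours r i with consecutive-neighbours r (toℕ<n i)
... | p , q , p<k , q<k , i~p , i~q , p≁q , p≢q =
  fromℕ< p<k , fromℕ< q<k ,
  subst (Consecutive k (toℕ i)) (sym (toℕ-fromℕ< p<k)) i~p ,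
  subst (Consecutive k (toℕ i)) (sym (toℕ-fromℕ< q<k)) i~q ,
  (λ p~q → p≁q (subst₂ (Consecutive k) (toℕ-fromℕ< p<k) (toℕ-fromℕ< q<k) p~q)) ,
  (λ p≡q → p≢q (subst₂ _≡_ (toℕ-fromℕ< p<k) (toℕ-fromℕ< q<k) (cong toℕ p≡q)))
  where
  k = 4 + r

induced-nonadjacent-neighbours : ∀ {k} (G : Graph n) {R : Fin k → Fin k → Set} {c : Fin k → Fin n} →
  Injective _≡_ _≡_ c → (∀ i j → (Adj G (c i) (c j) → R i j) × (R i j → Adj G (c i) (c j))) →
  ∀ {i} → NonadjacentNeighbours R i → NonadjacentNeighbours (Adj G) (c i)
induced-nonadjacent-neighbours G {c = c} c-injective c-induced (p , q , i~p , i~q , p≁q , p≢q) =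
  c p , c q , proj₂ (c-induced _ p) i~p , proj₂ (c-induced _ q) i~q ,
  (λ cp~cq → p≁q (proj₁ (c-induced p q) cp~cq)) , (λ cp≡cq → p≢q (c-injective cp≡cq))

proposition2p2 : {n : ℕ} (G : Graph n) → IsGreedoid (Ψ G)
    → (k : ℕ) → 4 ≤ k → (c : Fin k → Fin n) → IsInducedCycle G k c
    → (A : Subset n) → MaxStableIn G (InImage G c) A → ¬ Ψ G A
proposition2p2 G (_ , accessible , _) (suc (suc (suc (suc r)))) (s≤s (s≤s (s≤s (s≤s _))))
               c (c-injective , c-induced) A A-max@((A⊆C , _) , _) ΨA
  with accessible⇒singleton accessible ΨA (MaxStableIn⇒Nonempty G (fzero , refl) A-max)
... | a , a∈A , Ψ⁅a⁆ with A⊆C a a∈A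
... | i , refl with induced-nonadjacent-neighbours G c-injective c-induced (cycle-nonadjacent-neighbours r i)
... | u , w , a~u , a~w , u≁w , u≢w = u≢w (Ψ⁅a⁆⇒nonadjacent-neighbours-equal G Ψ⁅a⁆ a~u a~w u≁w)
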